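{- Every integer $n\ge 26177082$ belongs to $\mathcal{S}_3$, i.e. can be written as $n=\mu_1+\mu_2+\mu_3$ with positive integers $\mu_1,\mu_2,\mu_3$ such that $(\mu_1,\mu_2,\mu_3)=1$ and $(\mu_i,\mu_j)>1$ for all $i,j\in\{1,2,3\}$.
   Context: $(b_1,\ldots,b_k)$ denotes the greatest common divisor. $\mathcal{S}_3$ is the set of all sums $\mu_1+\mu_2+\mu_3$ of positive integers with $(\mu_1,\mu_2,\mu_3)=1$ and $(\mu_i,\mu_j)>1$ for each $i,j\in\{1,2,3\}$. -}

module Defs where

open import Data.Nat using (ℕ; _+_; _<_)
open import Data.Nat.GCD using (gcd)
open import Data.Product using (Σ; _×_; ∃-syntax)
open import Relation.Binary.PropositionalEquality using (_≡_)

gcd₃ : ℕ → ℕ → ℕ → ℕ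
gcd₃ a b c = gcd (gcd a b) c

Admissible : ℕ → ℕ → ℕ → Set
Admissible μ₁ μ₂ μ₃ =
  (0 < μ₁) × (0 < μ₂) × (0 < μ₃) ×
  (gcd₃ μ₁ μ₂ μ₃ ≡ 1) ×
  -- (μ_i, μ_i) = μ_i > 1 for each i, and (μ_i, μ_j) > 1 for i ≠ j
  (1 < gcd μ₁ μ₁) × (1 < gcd μ₂ μ₂) × (1 < gcd μ₃ μ₃) ×
  (1 < gcd μ₁ μ₂) × (1 < gcd μ₁ μ₃) × (1 < gcd μ₂ μ₃)

S₃ : ℕ → Set
S₃ n = ∃[ μ₁ ] ∃[ μ₂ ] ∃[ μ₃ ] (n ≡ μ₁ + μ₂ + μ₃ × Admissible μ₁ μ₂ μ₃)

-- Let p < q < r be the three least primes not dividing n.  If n ≥ 2r⁴, choose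
-- z < p with qrz ≡ n (mod p), then t < q with r(1 + zt) ≡ (n − qrz)/p (mod q);
-- this writes n = pqx + pr(1 + zt) + qrz with x, z > 0.  The summands pairwise
-- share one of p, q, r, while a common divisor of all three divides n, hence is
-- prime to p, q, r, and so divides the coprime numbers 1 + zt and z.
-- If n < 2r⁴, then npq ≤ 2r⁶ is divisible by every prime below r.  For
-- 60 ≤ r < 1024 this contradicts npq ≥ ∏_{s<60} s; for r ≥ 1024 it contradicts
-- Nair's bound lcm(m+1, …, 2m+1) ≥ 4^m with 2m + 2 = 2^e ≤ r, as every number
-- below 2^e whose prime factors divide npq divides (npq)^e.  Hence r ≤ 59, and
-- 2·59⁴ < 26177082.

module Submission where

open import Defs
open import Data.Nat
open import Data.Nat.Properties
open import Data.Nat.Divisibility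
open import Data.Nat.DivMod
open import Data.Nat.GCD
open import Data.Nat.LCM using (lcm; lcm-least; gcd*lcm)
open import Data.Nat.Coprimality as Coprimality using (Coprime; coprime-divisor; coprime-Bézout)
open import Data.Nat.Primality
open import Data.Nat.Primality.Factorisation using (factorise)
open import Data.List.Base using ([]; _∷_)
open import Data.List.Relation.Unary.All using (_∷_)
open import Data.Nat.Tactic.RingSolver using (solve-∀)
open import Data.Product using (∃-syntax; _×_; _,_; proj₁; proj₂)
open import Data.Sum using (_⊎_; inj₁; inj₂)
open import Relation.Nullary using (¬_; yes; no; contradiction)
open import Relation.Nullary.Decidable using (_×-dec_; ¬?; from-yes)
open import Relation.Unary using (Decidable)
open import Relation.Binary.Definitions using (tri<; tri≈; tri>)
open import Relation.Binary.PropositionalEquality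

private
  variable
    a d k m n s t x x′ y y′ z N : ℕ

prime∤⇒coprime : ∀ {p} → Prime p → p ∤ m → Coprime p m
prime∤⇒coprime pp p∤m (d∣p , d∣m) with prime⇒irreducible pp d∣p
... | inj₁ d≡1 = d≡1
... | inj₂ refl = contradiction d∣m p∤m

prime∤prime : ∀ {p q} → Prime p → Prime q → p ≢ q → p ∤ q
prime∤prime pp pq p≢q p∣q with prime⇒irreducible pq p∣q
... | inj₁ refl = ¬prime[1] pp
... | inj₂ p≡q = p≢q p≡q

prime∤* : ∀ {p} → Prime p → p ∤ m → p ∤ n → p ∤ m * n
prime∤* {m = m} {n = n} pp p∤m p∤n p∣mn with euclidsLemma m n pp p∣mn
... | inj₁ p∣m = p∤m p∣m
... | inj₂ p∣n = p∤n p∣n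

prime>0 : ∀ {p} → Prime p → 0 < p
prime>0 {p} pp = >-nonZero⁻¹ p {{prime⇒nonZero pp}}

m*n>0 : 0 < m → 0 < n → 0 < m * n
m*n>0 {m} {n} m>0 n>0 = >-nonZero⁻¹ (m * n) {{m*n≢0 m n {{>-nonZero m>0}} {{>-nonZero n>0}}}}

p∣m∧p∣n⇒1<gcd[m,n] : ∀ {p m n} → Prime p → p ∣ m → p ∣ n → 0 < m → 1 < gcd m n
p∣m∧p∣n⇒1<gcd[m,n] {p} {m} {n} pp p∣m p∣n m>0 = <-≤-trans (nonTrivial⇒n>1 p {{prime⇒nonTrivial pp}})
  (∣⇒≤ {{≢-nonZero (gcd[m,n]≢0 m n (inj₁ (n>0⇒n≢0 m>0)))}} (gcd-greatest p∣m p∣n))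

coprime⇒*∣ : Coprime m n → m ∣ k → n ∣ k → m * n ∣ k
coprime⇒*∣ {m} {n} m⊥n m∣k (divides j k≡jn) =
  subst (m * n ∣_) (sym k≡jn) (*-monoˡ-∣ n (coprime-divisor m⊥n (subst (m ∣_) (trans k≡jn (*-comm j n)) m∣k)))

∣p*m∧p∤n⇒∣m : ∀ {p} → d ∣ n → Prime p → p ∤ n → d ∣ p * m → d ∣ m
∣p*m∧p∤n⇒∣m d∣n pp p∤n = coprime-divisor
  (Coprimality.sym (prime∤⇒coprime pp (λ p∣d → p∤n (∣-trans p∣d d∣n))))

coprime[1+z*t,z] : Coprime (1 + z * t) z
coprime[1+z*t,z] {z} {t} {e} (e∣1+zt , e∣z) =
  ∣1⇒≡1 (∣m+n∣m⇒∣n (subst (e ∣_) (+-comm 1 (z * t)) e∣1+zt) (∣m⇒∣m*n t e∣z))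

module _ {s : ℕ} .{{_ : NonZero s}} where

  %-cong-* : x % s ≡ x′ % s → y % s ≡ y′ % s → (x * y) % s ≡ (x′ * y′) % s
  %-cong-* {x} {x′} {y} {y′} eqx eqy = begin
    (x * y) % s                ≡⟨ %-distribˡ-* x y s ⟩
    ((x % s) * (y % s)) % s    ≡⟨ cong₂ (λ u v → (u * v) % s) eqx eqy ⟩
    ((x′ % s) * (y′ % s)) % s  ≡⟨ %-distribˡ-* x′ y′ s ⟨
    (x′ * y′) % s              ∎
    where open ≡-Reasoning

  %≡%⇒≡+* : x % s ≡ y % s → x ≤ y → ∃[ k ] y ≡ x + k * s
  %≡%⇒≡+* {x} {y} eq x≤y = y / s ∸ x / s , (begin
    y                                       ≡⟨ m≡m%n+[m/n]*n y s ⟩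
    y % s + y / s * s                       ≡⟨ cong₂ _+_ eq (cong (_* s) (m+[n∸m]≡n (/-monoˡ-≤ s x≤y))) ⟨
    x % s + (x / s + (y / s ∸ x / s)) * s   ≡⟨ distribute (x % s) (x / s) (y / s ∸ x / s) s ⟩
    x % s + x / s * s + (y / s ∸ x / s) * s ≡⟨ cong (_+ (y / s ∸ x / s) * s) (m≡m%n+[m/n]*n x s) ⟨
    x + (y / s ∸ x / s) * s                 ∎)
    where
    open ≡-Reasoning
    distribute : ∀ u v w s → u + (v + w) * s ≡ u + v * s + w * s
    distribute = solve-∀

coprime⇒∃-inverse : .{{_ : NonZero s}} → Coprime a s → ∃[ u ] (a * u) % s ≡ 1 % s
coprime⇒∃-inverse {s} {a} cop with coprime-Bézout cop
... | Bézout.+- u v eq = u , (begin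
  (a * u) % s      ≡⟨ cong (_% s) (trans (*-comm a u) (sym eq)) ⟩
  (1 + v * s) % s  ≡⟨ [m+kn]%n≡m%n 1 v s ⟩
  1 % s            ∎)
  where open ≡-Reasoning
-- Here a * u ≡ -1 (mod s), so u * (s - 1) is an inverse.
coprime⇒∃-inverse {s@(suc s-1)} {a} cop | Bézout.-+ u v eq = u * s-1 , (begin
  (a * (u * s-1)) % s          ≡⟨ [m+n]%n≡m%n (a * (u * s-1)) s ⟨
  (a * (u * s-1) + s) % s      ≡⟨ cong (_% s) (expand a u s-1) ⟩
  (1 + (1 + u * a) * s-1) % s  ≡⟨ cong (λ w → (1 + w * s-1) % s) eq ⟩
  (1 + v * s * s-1) % s        ≡⟨ cong (λ w → (1 + w) % s) (*-comm (v * s) s-1) ⟩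
  (1 + s-1 * (v * s)) % s      ≡⟨ cong (λ w → (1 + w) % s) (*-assoc s-1 v s) ⟨
  (1 + s-1 * v * s) % s        ≡⟨ [m+kn]%n≡m%n 1 (s-1 * v) s ⟩
  1 % s                        ∎)
  where
  open ≡-Reasoning
  expand : ∀ a u s-1 → a * (u * s-1) + suc s-1 ≡ 1 + (1 + u * a) * s-1
  expand = solve-∀

coprime⇒congruence-solvable : .{{_ : NonZero s}} → Coprime a s → ∀ b → ∃[ t ] t < s × (a * t) % s ≡ b % s
coprime⇒congruence-solvable {s} {a} cop b with coprime⇒∃-inverse cop
... | u , au≡1 = (u * b) % s , m%n<n (u * b) s , (begin
  (a * ((u * b) % s)) % s  ≡⟨ %-cong-* {x = a} refl (m%n%n≡m%n (u * b) s) ⟩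
  (a * (u * b)) % s        ≡⟨ cong (_% s) (*-assoc a u b) ⟨
  (a * u * b) % s          ≡⟨ %-cong-* au≡1 refl ⟩
  (1 * b) % s              ≡⟨ cong (_% s) (*-identityˡ b) ⟩
  b % s                    ∎)
  where open ≡-Reasoning

coprime⇒∃-a*t+k*s : .{{_ : NonZero s}} → Coprime a s → a * s ≤ n →
                    ∃[ t ] t < s × ∃[ k ] n ≡ a * t + k * s
coprime⇒∃-a*t+k*s {s} {a} {n} a⊥s a*s≤n with coprime⇒congruence-solvable a⊥s n
... | t , t<s , at≡n = t , t<s , %≡%⇒≡+* at≡n (≤-trans (*-monoʳ-≤ a (<⇒≤ t<s)) a*s≤n)

S₃-pqx+pry+qrz : ∀ {p q r n x y z} → Prime p → Prime q → Prime r → p ∤ n → q ∤ n → r ∤ n →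
                 0 < x → 0 < y → 0 < z → Coprime y z →
                 n ≡ p * q * x + p * r * y + q * r * z → S₃ n
S₃-pqx+pry+qrz {p} {q} {r} {n} {x} {y} {z} pp pq pr p∤n q∤n r∤n x>0 y>0 z>0 y⊥z n≡ =
  μ₁ , μ₂ , μ₃ , n≡ , μ₁>0 , μ₂>0 , μ₃>0 , gcd₃≡1 ,
  p∣m∧p∣n⇒1<gcd[m,n] pp p∣μ₁ p∣μ₁ μ₁>0 ,
  p∣m∧p∣n⇒1<gcd[m,n] pr r∣μ₂ r∣μ₂ μ₂>0 ,
  p∣m∧p∣n⇒1<gcd[m,n] pr r∣μ₃ r∣μ₃ μ₃>0 ,
  p∣m∧p∣n⇒1<gcd[m,n] pp p∣μ₁ p∣μ₂ μ₁>0 ,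
  p∣m∧p∣n⇒1<gcd[m,n] pq q∣μ₁ q∣μ₃ μ₁>0 ,
  p∣m∧p∣n⇒1<gcd[m,n] pr r∣μ₂ r∣μ₃ μ₂>0
  where
  μ₁ μ₂ μ₃ : ℕ
  μ₁ = p * q * x
  μ₂ = p * r * y
  μ₃ = q * r * z
  μ₁>0 : 0 < μ₁
  μ₁>0 = m*n>0 (m*n>0 (prime>0 pp) (prime>0 pq)) x>0
  μ₂>0 : 0 < μ₂
  μ₂>0 = m*n>0 (m*n>0 (prime>0 pp) (prime>0 pr)) y>0
  μ₃>0 : 0 < μ₃
  μ₃>0 = m*n>0 (m*n>0 (prime>0 pq) (prime>0 pr)) z>0
  p∣μ₁ : p ∣ μ₁
  p∣μ₁ = ∣m⇒∣m*n x (m∣m*n q)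
  q∣μ₁ : q ∣ μ₁
  q∣μ₁ = ∣m⇒∣m*n x (n∣m*n p)
  p∣μ₂ : p ∣ μ₂
  p∣μ₂ = ∣m⇒∣m*n y (m∣m*n r)
  r∣μ₂ : r ∣ μ₂
  r∣μ₂ = ∣m⇒∣m*n y (n∣m*n p)
  q∣μ₃ : q ∣ μ₃
  q∣μ₃ = ∣m⇒∣m*n z (m∣m*n r)
  r∣μ₃ : r ∣ μ₃
  r∣μ₃ = ∣m⇒∣m*n z (n∣m*n q)
  gcd₃≡1 : gcd₃ μ₁ μ₂ μ₃ ≡ 1
  gcd₃≡1 = y⊥z (g∣y , g∣z)
    where
    g : ℕ
    g = gcd₃ μ₁ μ₂ μ₃
    g∣μ₁₂ : g ∣ gcd μ₁ μ₂
    g∣μ₁₂ = gcd[m,n]∣m (gcd μ₁ μ₂) μ₃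
    g∣μ₂ : g ∣ μ₂
    g∣μ₂ = ∣-trans g∣μ₁₂ (gcd[m,n]∣n μ₁ μ₂)
    g∣μ₃ : g ∣ μ₃
    g∣μ₃ = gcd[m,n]∣n (gcd μ₁ μ₂) μ₃
    g∣n : g ∣ n
    g∣n = subst (g ∣_) (sym n≡)
      (∣m∣n⇒∣m+n (∣m∣n⇒∣m+n (∣-trans g∣μ₁₂ (gcd[m,n]∣m μ₁ μ₂)) g∣μ₂) g∣μ₃)
    g∣y : g ∣ y
    g∣y = ∣p*m∧p∤n⇒∣m g∣n pr r∤n (∣p*m∧p∤n⇒∣m g∣n pp p∤n
            (subst (g ∣_) (*-assoc p r y) g∣μ₂))
    g∣z : g ∣ z
    g∣z = ∣p*m∧p∤n⇒∣m g∣n pr r∤n (∣p*m∧p∤n⇒∣m g∣n pq q∤n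
            (subst (g ∣_) (*-assoc q r z) g∣μ₃))

S₃-qrz+mp : ∀ {p q r n z m} → Prime p → Prime q → Prime r → p < q → q < r → p ∤ n → q ∤ n → r ∤ n →
            0 < z → z < p → r * (1 + p * q) ≤ m → n ≡ q * r * z + m * p → S₃ n
S₃-qrz+mp {p} {q} {r} {n} {z} {m} pp pq pr p<q q<r p∤n q∤n r∤n z>0 z<p m≥ n≡ =
  choose-x (coprime⇒∃-a*t+k*s {{prime⇒nonZero pq}} rz⊥q rzq≤m∸r)
  where
  rz⊥q : Coprime (r * z) q
  rz⊥q = Coprimality.sym (prime∤⇒coprime pq
           (prime∤* pq (prime∤prime pq pr (<⇒≢ q<r)) (>⇒∤ {{>-nonZero z>0}} (<-trans z<p p<q))))
  r≤m : r ≤ m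
  r≤m = ≤-trans (m≤m*n r (1 + p * q)) m≥
  rzq≤m∸r : r * z * q ≤ m ∸ r
  rzq≤m∸r = +-cancelˡ-≤ r _ _ (begin
    r + r * z * q   ≤⟨ +-monoʳ-≤ r (*-monoˡ-≤ q (*-monoʳ-≤ r (<⇒≤ z<p))) ⟩
    r + r * p * q   ≡⟨ expand r p q ⟩
    r * (1 + p * q) ≤⟨ m≥ ⟩
    m               ≡⟨ m+[n∸m]≡n r≤m ⟨
    r + (m ∸ r)     ∎)
    where
    open ≤-Reasoning
    expand : ∀ r p q → r + r * p * q ≡ r * (1 + p * q)
    expand = solve-∀
  choose-x : (∃[ t ] t < q × ∃[ x ] m ∸ r ≡ r * z * t + x * q) → S₃ n
  choose-x (t , _ , x , m∸r≡) =
    S₃-pqx+pry+qrz pp pq pr p∤n q∤n r∤n x>0 (s≤s z≤n) z>0 coprime[1+z*t,z] n≡pqx+pry+qrz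
    where
    n≡pqx+pry+qrz : n ≡ p * q * x + p * r * (1 + z * t) + q * r * z
    n≡pqx+pry+qrz = begin
      n                                         ≡⟨ n≡ ⟩
      q * r * z + m * p                         ≡⟨ cong (λ w → q * r * z + w * p) (m+[n∸m]≡n r≤m) ⟨
      q * r * z + (r + (m ∸ r)) * p             ≡⟨ cong (λ w → q * r * z + (r + w) * p) m∸r≡ ⟩
      q * r * z + (r + (r * z * t + x * q)) * p ≡⟨ rearrange p q r x z t ⟩
      p * q * x + p * r * (1 + z * t) + q * r * z ∎
      where
      open ≡-Reasoning
      rearrange : ∀ p q r x z t →
        q * r * z + (r + (r * z * t + x * q)) * p ≡ p * q * x + p * r * (1 + z * t) + q * r * z
      rearrange = solve-∀
    x>0 : 0 < x
    x>0 = n≢0⇒n>0 λ { refl → r∤n (subst (r ∣_) (sym n≡pqx+pry+qrz)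
      (∣m∣n⇒∣m+n (∣m∣n⇒∣m+n (subst (r ∣_) (sym (*-zeroʳ (p * q))) (r ∣0))
                             (∣m⇒∣m*n (1 + z * t) (n∣m*n p)))
                  (∣m⇒∣m*n z (n∣m*n q)))) }

prime∤n⇒S₃ : ∀ {p q r n} → Prime p → Prime q → Prime r → p < q → q < r → p ∤ n → q ∤ n → r ∤ n →
             q * r * p + r * (1 + p * q) * p ≤ n → S₃ n
prime∤n⇒S₃ {p} {q} {r} {n} pp pq pr p<q q<r p∤n q∤n r∤n n≥ =
  choose-z (coprime⇒∃-a*t+k*s {{prime⇒nonZero pp}} qr⊥p (≤-trans (m≤m+n _ _) n≥))
  where
  qr⊥p : Coprime (q * r) p
  qr⊥p = Coprimality.sym (prime∤⇒coprime pp
           (prime∤* pp (prime∤prime pp pq (<⇒≢ p<q)) (prime∤prime pp pr (<⇒≢ (<-trans p<q q<r)))))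
  choose-z : (∃[ z ] z < p × ∃[ m ] n ≡ q * r * z + m * p) → S₃ n
  choose-z (z , z<p , m , n≡) = S₃-qrz+mp pp pq pr p<q q<r p∤n q∤n r∤n z>0 z<p m≥ n≡
    where
    z>0 : 0 < z
    z>0 = n≢0⇒n>0 λ { refl → p∤n (divides m (trans n≡ (cong (_+ m * p) (*-zeroʳ (q * r))))) }
    m≥ : r * (1 + p * q) ≤ m
    m≥ = *-cancelʳ-≤ _ m p {{prime⇒nonZero pp}} (+-cancelˡ-≤ (q * r * z) _ _ (begin
      q * r * z + r * (1 + p * q) * p ≤⟨ +-monoˡ-≤ _ (*-monoʳ-≤ (q * r) (<⇒≤ z<p)) ⟩
      q * r * p + r * (1 + p * q) * p ≤⟨ n≥ ⟩
      n                               ≡⟨ n≡ ⟩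
      q * r * z + m * p               ∎))
      where open ≤-Reasoning

threshold≤2r⁴ : ∀ {p q r} → p < q → q < r → q * r * p + r * (1 + p * q) * p ≤ 2 * r ^ 4
threshold≤2r⁴ {p} {q} {r} p<q q<r = begin
  q * r * p + r * (1 + p * q) * p      ≤⟨ +-mono-≤ (*-mono-≤ (*-monoˡ-≤ r q≤r) p≤r)
                                            (*-mono-≤ (*-monoʳ-≤ r (+-monoʳ-≤ 1 (*-mono-≤ p≤r q≤r))) p≤r) ⟩
  r * r * r + r * (1 + r * r) * r      ≤⟨ r³+r²+r⁴≤2r⁴ r (≤-trans (s≤s (s≤s z≤n)) (≤-trans (s≤s p<q) q<r)) ⟩
  2 * r ^ 4                            ∎
  where
  open ≤-Reasoning
  q≤r : q ≤ r
  q≤r = <⇒≤ q<r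
  p≤r : p ≤ r
  p≤r = <⇒≤ (<-trans p<q q<r)
  r³+r²+r⁴≤2r⁴ : ∀ r → 2 ≤ r → r * r * r + r * (1 + r * r) * r ≤ 2 * r ^ 4
  r³+r²+r⁴≤2r⁴ 1 (s≤s ())
  r³+r²+r⁴≤2r⁴ r@(suc (suc s)) _ = ≤-trans (m≤m+n _ (r * r * (s * s + 3 * s + 1))) (≤-reflexive (slack s))
    where
    -- powers are written out because the ring solver does not handle _^_
    slack : ∀ s → (2 + s) * (2 + s) * (2 + s) + (2 + s) * (1 + (2 + s) * (2 + s)) * (2 + s)
                  + (2 + s) * (2 + s) * (s * s + 3 * s + 1) ≡ 2 * ((2 + s) * ((2 + s) * ((2 + s) * ((2 + s) * 1))))
    slack = solve-∀

∃-prime-factor : 1 < n → ∃[ p ] Prime p × p ∣ n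
∃-prime-factor {1} (s≤s ())
∃-prime-factor {n@(suc (suc _))} _ with factorise n
... | record { factors = [] ; isFactorisation = () }
... | record { factors = p ∷ _ ; isFactorisation = n≡ ; factorsPrime = pp ∷ _ } =
  p , pp , subst (p ∣_) (sym n≡) (m∣m*n _)

0<m≤n⇒m∣n! : 0 < m → m ≤ n → m ∣ n !
0<m≤n⇒m∣n! {suc m} _ m≤n = ∣-trans (m∣m*n (m !)) (m≤n⇒m!∣n! m≤n)

PrimeNondivisor : ℕ → ℕ → Set
PrimeNondivisor n s = Prime s × s ∤ n

primeNondivisor? : ∀ n → Decidable (PrimeNondivisor n)
primeNondivisor? n s = prime? s ×-dec ¬? (s ∣? n)

∃-primeNondivisor≥ : 0 < n → ∀ a → ∃[ s ] a ≤ s × PrimeNondivisor n s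
∃-primeNondivisor≥ {n} n>0 a with ∃-prime-factor {n * a ! + 1} (+-monoˡ-< 1 (m*n>0 n>0 (1≤n! a)))
... | s , ps , s∣N = s , a≤s , ps , λ s∣n → s∤n*a! (∣m⇒∣m*n (a !) s∣n)
  where
  s∤n*a! : s ∤ n * a !
  s∤n*a! s∣n*a! = ¬prime[1] (subst Prime (∣1⇒≡1 (∣m+n∣m⇒∣n s∣N s∣n*a!)) ps)
  a≤s : a ≤ s
  a≤s = ≮⇒≥ λ s<a → s∤n*a! (∣n⇒∣m*n n (0<m≤n⇒m∣n! (prime>0 ps) (<⇒≤ s<a)))

least≥ : {P : ℕ → Set} → Decidable P → ∀ k a → P (k + a) →
         ∃[ s ] a ≤ s × P s × (∀ {j} → a ≤ j → j < s → ¬ P j)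
least≥ P? k a Pk+a with P? a
... | yes Pa = a , ≤-refl , Pa , λ a≤j j<a → contradiction a≤j (<⇒≱ j<a)
least≥ P? zero a Pa | no ¬Pa = contradiction Pa ¬Pa
least≥ {P} P? (suc k) a Pk+a | no ¬Pa with least≥ P? k (suc a) (subst P (sym (+-suc k a)) Pk+a)
... | s , a<s , Ps , none = s , <⇒≤ a<s , Ps , none′
  where
  none′ : ∀ {j} → a ≤ j → j < s → ¬ P j
  none′ a≤j j<s with m≤n⇒m<n∨m≡n a≤j
  ... | inj₁ a<j = none a<j j<s
  ... | inj₂ refl = ¬Pa

leastPrimeNondivisor≥ : 0 < n → ∀ a →
  ∃[ s ] a ≤ s × PrimeNondivisor n s × (∀ {j} → a ≤ j → j < s → ¬ PrimeNondivisor n j)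
leastPrimeNondivisor≥ {n} n>0 a with ∃-primeNondivisor≥ n>0 a
... | w , a≤w , w-nd =
  least≥ (primeNondivisor? n) (w ∸ a) a (subst (PrimeNondivisor n) (sym (m∸n+n≡m a≤w)) w-nd)

PrimesBelow_Divide_ : ℕ → ℕ → Set
PrimesBelow r Divide N = ∀ {s} → Prime s → s < r → s ∣ N

primorial : ℕ → ℕ
primorial zero = 1
primorial (suc k) with prime? k
... | yes _ = k * primorial k
... | no _  = primorial k

prime∣primorial⇒< : ∀ k → Prime s → s ∣ primorial k → s < k
prime∣primorial⇒< zero    ps s∣1 = contradiction (subst Prime (∣1⇒≡1 s∣1) ps) ¬prime[1]
prime∣primorial⇒< (suc k) ps s∣ with prime? k
... | no _ = m<n⇒m<1+n (prime∣primorial⇒< k ps s∣)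
... | yes pk with euclidsLemma k (primorial k) ps s∣
...   | inj₁ s∣k = s≤s (∣⇒≤ {{prime⇒nonZero pk}} s∣k)
...   | inj₂ s∣primorial = m<n⇒m<1+n (prime∣primorial⇒< k ps s∣primorial)

primesBelow∣⇒primorial∣ : ∀ k → PrimesBelow k Divide N → primorial k ∣ N
primesBelow∣⇒primorial∣ zero    _    = 1∣ _
primesBelow∣⇒primorial∣ (suc k) all∣ with prime? k
... | no _   = primesBelow∣⇒primorial∣ k (λ ps s<k → all∣ ps (m<n⇒m<1+n s<k))
... | yes pk = coprime⇒*∣ (prime∤⇒coprime pk (λ k∣ → <-irrefl refl (prime∣primorial⇒< k pk k∣)))
                 (all∣ pk ≤-refl) (primesBelow∣⇒primorial∣ k (λ ps s<k → all∣ ps (m<n⇒m<1+n s<k)))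

infixr 8 _↑_
_↑_ : ℕ → ℕ → ℕ
k ↑ zero  = 1
k ↑ suc i = k * (suc k ↑ i)

↑-suc : ∀ k i → k ↑ suc i ≡ k ↑ i * (k + i)
↑-suc k zero = trans (*-comm k 1) (cong (1 *_) (sym (+-identityʳ k)))
↑-suc k (suc i) = begin
  k * (suc k ↑ suc i)              ≡⟨ cong (k *_) (↑-suc (suc k) i) ⟩
  k * (suc k ↑ i * (suc k + i))    ≡⟨ *-assoc k _ _ ⟨
  k * (suc k ↑ i) * (suc k + i)    ≡⟨ cong (k * (suc k ↑ i) *_) (+-suc k i) ⟨
  k * (suc k ↑ i) * (k + suc i)    ∎
  where open ≡-Reasoning

↑>0 : ∀ k i → 0 < suc k ↑ i
↑>0 k zero    = s≤s z≤n
↑>0 k (suc i) = m*n>0 {suc k} (s≤s z≤n) (↑>0 (suc k) i)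

↑*!≡! : ∀ k i → suc k ↑ i * k ! ≡ (k + i) !
↑*!≡! k zero    = trans (+-identityʳ (k !)) (cong _! (sym (+-identityʳ k)))
↑*!≡! k (suc i) = begin
  suc k ↑ suc i * k !              ≡⟨ cong (_* k !) (↑-suc (suc k) i) ⟩
  suc k ↑ i * (suc k + i) * k !    ≡⟨ swap (suc k ↑ i) (suc k + i) (k !) ⟩
  (suc k + i) * (suc k ↑ i * k !)  ≡⟨ cong ((suc k + i) *_) (↑*!≡! k i) ⟩
  (suc k + i) * (k + i) !          ≡⟨ cong _! (+-suc k i) ⟨
  (k + suc i) !                    ∎
  where
  open ≡-Reasoning
  swap : ∀ a b c → a * b * c ≡ b * (a * c)
  swap = solve-∀

a*c∣x∧c*b∣x⇒a*[c*b]∣x*gcd[a,b] : ∀ {a b c x} → 0 < c → a * c ∣ x → c * b ∣ x → a * (c * b) ∣ x * gcd a b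
a*c∣x∧c*b∣x⇒a*[c*b]∣x*gcd[a,b] {a} {b} {c} {x} c>0 ac∣x cb∣x =
  subst (_∣ x * gcd a b) gcd*lcm≡
    (subst (gcd a b * lcm (a * c) (c * b) ∣_) (*-comm (gcd a b) x) (*-monoʳ-∣ (gcd a b) (lcm-least ac∣x cb∣x)))
  where
  gcd*lcm≡ : gcd a b * lcm (a * c) (c * b) ≡ a * (c * b)
  gcd*lcm≡ = *-cancelˡ-≡ _ _ c {{>-nonZero c>0}} (begin
    c * (gcd a b * lcm (a * c) (c * b))      ≡⟨ *-assoc c _ _ ⟨
    c * gcd a b * lcm (a * c) (c * b)        ≡⟨ cong₂ (λ u v → u * lcm v (c * b))
                                                       (c*gcd[m,n]≡gcd[cm,cn] c a b) (*-comm a c) ⟩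
    gcd (c * a) (c * b) * lcm (c * a) (c * b) ≡⟨ gcd*lcm (c * a) (c * b) ⟩
    c * a * (c * b)                          ≡⟨ rearrange c a b ⟩
    c * (a * (c * b))                        ∎)
    where
    open ≡-Reasoning
    rearrange : ∀ c a b → c * a * (c * b) ≡ c * (a * (c * b))
    rearrange = solve-∀

-- gcd (k + 1) (k + 2 + i) divides i + 1, so merging the instances for k + 1, …, k + 1 + i
-- and k + 2, …, k + 2 + i loses only a factor i + 1.
consecutive∣⇒↑∣ : ∀ i k L → (∀ {l} → l ≤ i → suc k + l ∣ L) → suc k ↑ suc i ∣ L * i !
consecutive∣⇒↑∣ zero k L all∣ =
  subst₂ _∣_ (sym (*-identityʳ (suc k))) (sym (*-identityʳ L)) (subst (_∣ L) (+-identityʳ (suc k)) (all∣ z≤n))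
consecutive∣⇒↑∣ (suc i) k L all∣ = ∣-trans step (∣-reflexive (distribute L (i !) i))
  where
  X : ℕ
  X = L * i !
  lower : suc k * (suc (suc k) ↑ i) ∣ X
  lower = consecutive∣⇒↑∣ i k L (λ l≤i → all∣ (m≤n⇒m≤1+n l≤i))
  upper : suc (suc k) ↑ i * (suc (suc k) + i) ∣ X
  upper = subst (_∣ X) (↑-suc (suc (suc k)) i)
    (consecutive∣⇒↑∣ i (suc k) L (λ {l} l≤i → subst (_∣ L) (+-suc (suc k) l) (all∣ (s≤s l≤i))))
  g : ℕ
  g = gcd (suc k) (suc (suc k) + i)
  g∣suc-i : g ∣ suc i
  g∣suc-i = ∣m+n∣m⇒∣n (subst (g ∣_) (sym (+-suc (suc k) i)) (gcd[m,n]∣n (suc k) (suc (suc k) + i)))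
                      (gcd[m,n]∣m (suc k) (suc (suc k) + i))
  step : suc k ↑ suc (suc i) ∣ X * suc i
  step = subst (_∣ X * suc i) (cong (suc k *_) (sym (↑-suc (suc (suc k)) i)))
           (∣-trans (a*c∣x∧c*b∣x⇒a*[c*b]∣x*gcd[a,b] {suc k} (↑>0 (suc k) i) lower upper) (*-monoʳ-∣ X g∣suc-i))
  distribute : ∀ L f i → L * f * suc i ≡ L * (f + i * f)
  distribute = solve-∀

4^m*m!*m!≤[2m+1]! : ∀ m → 4 ^ m * (m ! * m !) ≤ (2 * m + 1) !
4^m*m!*m!≤[2m+1]! zero    = s≤s z≤n
4^m*m!*m!≤[2m+1]! (suc m) = begin
  4 ^ suc m * (suc m ! * suc m !)             ≡⟨ regroup (4 ^ m) (m !) m ⟩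
  4 * (suc m * suc m) * (4 ^ m * (m ! * m !)) ≤⟨ *-monoʳ-≤ (4 * (suc m * suc m)) (4^m*m!*m!≤[2m+1]! m) ⟩
  4 * (suc m * suc m) * F                     ≤⟨ m≤m+n _ (2 * suc m * F) ⟩
  4 * (suc m * suc m) * F + 2 * suc m * F     ≡⟨ factor m F ⟩
  (suc (suc (2 * m + 1))) !                   ≡⟨ cong _! (shift m) ⟩
  (2 * suc m + 1) !                           ∎
  where
  open ≤-Reasoning
  F : ℕ
  F = (2 * m + 1) !
  regroup : ∀ A B m → 4 * A * ((B + m * B) * (B + m * B)) ≡ 4 * (suc m * suc m) * (A * (B * B))
  regroup = solve-∀
  factor : ∀ m F → 4 * (suc m * suc m) * F + 2 * suc m * F ≡ suc (suc (2 * m + 1)) * (suc (2 * m + 1) * F)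
  factor = solve-∀
  shift : ∀ m → suc (suc (2 * m + 1)) ≡ 2 * suc m + 1
  shift = solve-∀

consecutive∣⇒4^m≤ : ∀ m L → 0 < L → (∀ {l} → l ≤ m → suc m + l ∣ L) → 4 ^ m ≤ L
consecutive∣⇒4^m≤ m L L>0 all∣ = *-cancelʳ-≤ (4 ^ m) L (m ! * m !) {{m!*m!≢0}} (begin
  4 ^ m * (m ! * m !)       ≤⟨ 4^m*m!*m!≤[2m+1]! m ⟩
  (2 * m + 1) !             ≡⟨ cong _! (twice m) ⟩
  (m + suc m) !             ≡⟨ ↑*!≡! m (suc m) ⟨
  suc m ↑ suc m * m !       ≤⟨ ∣⇒≤ {{m*n≢0 L (m ! * m !) {{>-nonZero L>0}} {{m!*m!≢0}}}}
                                 (subst (suc m ↑ suc m * m ! ∣_) (*-assoc L (m !) (m !))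
                                   (*-monoˡ-∣ (m !) (consecutive∣⇒↑∣ m m L all∣))) ⟩
  L * (m ! * m !)           ∎)
  where
  open ≤-Reasoning
  m!*m!≢0 : NonZero (m ! * m !)
  m!*m!≢0 = m*n≢0 (m !) (m !) {{m !≢0}} {{m !≢0}}
  twice : ∀ m → 2 * m + 1 ≡ m + suc m
  twice = solve-∀

-- j < 2 ^ e has fewer than e prime factors counted with multiplicity.
primeFactors∣⇒∣^ : ∀ N e j → 0 < j → j < 2 ^ e → (∀ {s} → Prime s → s ∣ j → s ∣ N) → j ∣ N ^ e
primeFactors∣⇒∣^ N zero    (suc zero)          _ (s≤s ()) _
primeFactors∣⇒∣^ N (suc e) (suc zero)          _ _        _ = 1∣ _
primeFactors∣⇒∣^ N (suc e) j@(suc (suc _)) _ j<2^e+1 all∣ with ∃-prime-factor {j} (s≤s (s≤s z≤n))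
... | s , ps , s∣j@(divides j′ j≡j′s) = subst (_∣ N ^ suc e) (trans (*-comm s j′) (sym j≡j′s))
        (*-pres-∣ (all∣ ps s∣j)
          (primeFactors∣⇒∣^ N e j′ j′>0 j′<2^e (λ pt t∣j′ → all∣ pt (∣-trans t∣j′ j′∣j))))
  where
  j′∣j : j′ ∣ j
  j′∣j = divides s (trans j≡j′s (*-comm j′ s))
  j′>0 : 0 < j′
  j′>0 = n≢0⇒n>0 λ { refl → contradiction j≡j′s λ () }
  j′<2^e : j′ < 2 ^ e
  j′<2^e = *-cancelˡ-< 2 j′ (2 ^ e) (begin-strict
    2 * j′   ≤⟨ *-monoˡ-≤ j′ (nonTrivial⇒n>1 s {{prime⇒nonTrivial ps}}) ⟩
    s * j′   ≡⟨ trans (*-comm s j′) (sym j≡j′s) ⟩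
    j        <⟨ j<2^e+1 ⟩
    2 ^ suc e ∎)
    where open ≤-Reasoning

∃-log₂ : ∀ n → ∃[ e ] 2 ^ e ≤ suc n × suc n < 2 ^ suc e
∃-log₂ zero = 0 , ≤-refl , s≤s (s≤s z≤n)
∃-log₂ (suc n) with ∃-log₂ n
... | e , 2^e≤ , <2^e+1 with m≤n⇒m<n∨m≡n <2^e+1
...   | inj₁ <2^e+1′ = e , m≤n⇒m≤1+n 2^e≤ , <2^e+1′
...   | inj₂ ≡2^e+1  = suc e , ≤-reflexive (sym ≡2^e+1) ,
                       subst (_< 2 ^ suc (suc e)) (sym ≡2^e+1) (^-monoʳ-< 2 (s≤s (s≤s z≤n)) {suc e} ≤-refl)

[1+6[e+1]]e+2<2^e : ∀ e → 10 ≤ e → (1 + suc e * 6) * e + 2 < 2 ^ e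
[1+6[e+1]]e+2<2^e e 10≤e = subst (λ e → (1 + suc e * 6) * e + 2 < 2 ^ e) (m+[n∸m]≡n 10≤e) (go (e ∸ 10))
  where
  go : ∀ d → (1 + suc (10 + d) * 6) * (10 + d) + 2 < 2 ^ (10 + d)
  go zero    = m≤m+n 673 351
  go (suc d) = ≤-<-trans (≤-trans (m≤m+n _ _) (≤-reflexive (doubling d))) (*-monoʳ-< 2 (go d))
    where
    doubling : ∀ d → (1 + suc (10 + suc d) * 6) * (10 + suc d) + 2 + (6 * d * d + 115 * d + 539)
                     ≡ 2 * ((1 + suc (10 + d) * 6) * (10 + d) + 2)
    doubling = solve-∀

primesBelow∣⇒4^[2^k-1]≤N^[k+1] : ∀ k → 0 < N → PrimesBelow 2 ^ suc k Divide N → 4 ^ pred (2 ^ k) ≤ N ^ suc k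
primesBelow∣⇒4^[2^k-1]≤N^[k+1] {N} k N>0 all∣ =
  consecutive∣⇒4^m≤ m₀ (N ^ suc k) (m^n>0 N {{>-nonZero N>0}} (suc k)) λ {l} l≤m₀ →
    primeFactors∣⇒∣^ N (suc k) (suc m₀ + l) (s≤s z≤n) (j<2^k+1 l≤m₀)
      (λ ps s∣j → all∣ ps (≤-<-trans (∣⇒≤ s∣j) (j<2^k+1 l≤m₀)))
  where
  m₀ : ℕ
  m₀ = pred (2 ^ k)
  j<2^k+1 : ∀ {l} → l ≤ m₀ → suc m₀ + l < 2 ^ suc k
  j<2^k+1 {l} l≤m₀ = begin-strict
    suc m₀ + l       ≤⟨ +-monoʳ-≤ (suc m₀) l≤m₀ ⟩
    suc m₀ + m₀      <⟨ +-monoʳ-< (suc m₀) ≤-refl ⟩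
    suc m₀ + suc m₀  ≡⟨ cong (λ w → w + w) (suc-pred (2 ^ k) {{m^n≢0 2 k}}) ⟩
    2 ^ k + 2 ^ k    ≡⟨ cong (2 ^ k +_) (+-identityʳ (2 ^ k)) ⟨
    2 ^ suc k        ∎
    where open ≤-Reasoning

primesBelow∣∧1024≤r⇒2r⁶<N : ∀ {r} → 0 < N → PrimesBelow r Divide N → 1024 ≤ r → 2 * r ^ 6 < N
primesBelow∣∧1024≤r⇒2r⁶<N {N} {r@(suc r′)} N>0 all∣ 1024≤r with ∃-log₂ r′
... | e , 2^e≤r , r<2^e+1 = ≰⇒> (impossible e 10≤e 2^e≤r r<2^e+1)
  where
  10≤e : 10 ≤ e
  10≤e = ≮⇒≥ λ e<10 → <-irrefl refl (<-≤-trans r<2^e+1 (≤-trans (^-monoʳ-≤ 2 e<10) 1024≤r))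
  impossible : ∀ e → 10 ≤ e → 2 ^ e ≤ r → r < 2 ^ suc e → ¬ N ≤ 2 * r ^ 6
  impossible (suc k) 10≤e 2^e≤r r<2^e+1 N≤2r⁶ = <-irrefl refl (begin-strict
    4 ^ m₀                           ≤⟨ primesBelow∣⇒4^[2^k-1]≤N^[k+1] k N>0
                                          (λ ps s<2^e → all∣ ps (<-≤-trans s<2^e 2^e≤r)) ⟩
    N ^ suc k                        ≤⟨ ^-monoˡ-≤ (suc k) (≤-trans N≤2r⁶ (*-monoʳ-≤ 2 r⁶≤)) ⟩
    (2 ^ (1 + suc (suc k) * 6)) ^ suc k ≡⟨ ^-*-assoc 2 (1 + suc (suc k) * 6) (suc k) ⟩
    2 ^ ((1 + suc (suc k) * 6) * suc k) <⟨ ^-monoʳ-< 2 (s≤s (s≤s z≤n)) exponent< ⟩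
    2 ^ (2 * m₀)                     ≡⟨ ^-*-assoc 2 2 m₀ ⟨
    4 ^ m₀                           ∎)
    where
    open ≤-Reasoning
    m₀ : ℕ
    m₀ = pred (2 ^ k)
    r⁶≤ : r ^ 6 ≤ 2 ^ (suc (suc k) * 6)
    r⁶≤ = ≤-trans (^-monoˡ-≤ 6 (<⇒≤ r<2^e+1)) (≤-reflexive (^-*-assoc 2 (suc (suc k)) 6))
    exponent< : (1 + suc (suc k) * 6) * suc k < 2 * m₀
    exponent< = +-cancelʳ-< 2 _ _ (<-≤-trans ([1+6[e+1]]e+2<2^e (suc k) 10≤e) (≤-reflexive (begin-equality
      2 * 2 ^ k          ≡⟨ cong (2 *_) (suc-pred (2 ^ k) {{m^n≢0 2 k}}) ⟨
      2 * suc m₀         ≡⟨ *-suc 2 m₀ ⟩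
      2 + 2 * m₀         ≡⟨ +-comm 2 (2 * m₀) ⟩
      2 * m₀ + 2         ∎)))

primesBelow∣∧60≤r⇒2r⁶<N : ∀ {r} → 0 < N → PrimesBelow r Divide N → 60 ≤ r → 2 * r ^ 6 < N
primesBelow∣∧60≤r⇒2r⁶<N {N} {r} N>0 all∣ 60≤r with r <? 1024
... | no r≮1024  = primesBelow∣∧1024≤r⇒2r⁶<N N>0 all∣ (≮⇒≥ r≮1024)
... | yes r<1024 = begin-strict
  2 * r ^ 6      ≤⟨ *-monoʳ-≤ 2 (^-monoˡ-≤ 6 (≤-pred r<1024)) ⟩
  2 * 1023 ^ 6   <⟨ from-yes (2 * 1023 ^ 6 <? primorial 60) ⟩
  primorial 60   ≤⟨ ∣⇒≤ {{>-nonZero N>0}}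
                      (primesBelow∣⇒primorial∣ 60 (λ ps s<60 → all∣ ps (<-≤-trans s<60 60≤r))) ⟩
  N              ∎
  where open ≤-Reasoning

record ThreeLeastPrimeNondivisors (n : ℕ) : Set where
  field
    p q r : ℕ
    p<q : p < q
    q<r : q < r
    p-nondivisor : PrimeNondivisor n p
    q-nondivisor : PrimeNondivisor n q
    r-nondivisor : PrimeNondivisor n r
    others : ∀ {s} → PrimeNondivisor n s → s < r → s ≡ p ⊎ s ≡ q

  prime<r⇒∣n*p*q : Prime s → s < r → s ∣ n * p * q
  prime<r⇒∣n*p*q {s} ps s<r with s ∣? n
  ... | yes s∣n = ∣m⇒∣m*n q (∣m⇒∣m*n p s∣n)
  ... | no s∤n with others (ps , s∤n) s<r
  ...   | inj₁ refl = ∣m⇒∣m*n q (n∣m*n n)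
  ...   | inj₂ refl = n∣m*n (n * p)

  n<2r⁴⇒r<60 : 0 < n → n < 2 * r ^ 4 → r < 60
  n<2r⁴⇒r<60 n>0 n<2r⁴ =
    ≰⇒> λ 60≤r → <⇒≱ (primesBelow∣∧60≤r⇒2r⁶<N npq>0 prime<r⇒∣n*p*q 60≤r) npq≤2r⁶
    where
    npq>0 : 0 < n * p * q
    npq>0 = m*n>0 (m*n>0 n>0 (prime>0 (proj₁ p-nondivisor))) (prime>0 (proj₁ q-nondivisor))
    npq≤2r⁶ : n * p * q ≤ 2 * r ^ 6
    npq≤2r⁶ = ≤-trans (*-mono-≤ (*-mono-≤ (<⇒≤ n<2r⁴) (<⇒≤ (<-trans p<q q<r))) (<⇒≤ q<r))
                      (≤-reflexive (2r⁴*r*r≡2r⁶ r))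
      where
      2r⁴*r*r≡2r⁶ : ∀ r → 2 * (r * (r * (r * (r * 1)))) * r * r ≡ 2 * (r * (r * (r * (r * (r * (r * 1))))))
      2r⁴*r*r≡2r⁶ = solve-∀

  2r⁴≤n : 26177082 ≤ n → 2 * r ^ 4 ≤ n
  2r⁴≤n n≥ = ≮⇒≥ λ n<2r⁴ → <-irrefl refl (begin-strict
    26177082   ≤⟨ n≥ ⟩
    n          <⟨ n<2r⁴ ⟩
    2 * r ^ 4  ≤⟨ *-monoʳ-≤ 2 (^-monoˡ-≤ 4 (≤-pred (n<2r⁴⇒r<60 (≤-trans (s≤s z≤n) n≥) n<2r⁴))) ⟩
    2 * 59 ^ 4 <⟨ from-yes (2 * 59 ^ 4 <? 26177082) ⟩
    26177082   ∎)
    where open ≤-Reasoning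

threeLeastPrimeNondivisors : 0 < n → ThreeLeastPrimeNondivisors n
threeLeastPrimeNondivisors {n} n>0 with leastPrimeNondivisor≥ n>0 0
... | p , _ , p-nd , below-p with leastPrimeNondivisor≥ n>0 (suc p)
... | q , p<q , q-nd , between-pq with leastPrimeNondivisor≥ n>0 (suc q)
... | r , q<r , r-nd , between-qr = record
  { p = p ; q = q ; r = r ; p<q = p<q ; q<r = q<r
  ; p-nondivisor = p-nd ; q-nondivisor = q-nd ; r-nondivisor = r-nd ; others = others }
  where
  others : ∀ {s} → PrimeNondivisor n s → s < r → s ≡ p ⊎ s ≡ q
  others {s} s-nd s<r with <-cmp s p | <-cmp s q
  ... | tri< s<p _ _ | _            = contradiction s-nd (below-p z≤n s<p)
  ... | tri≈ _ s≡p _ | _            = inj₁ s≡p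
  ... | tri> _ _ p<s | tri< s<q _ _ = contradiction s-nd (between-pq p<s s<q)
  ... | tri> _ _ _   | tri≈ _ s≡q _ = inj₂ s≡q
  ... | tri> _ _ _   | tri> _ _ q<s = contradiction s-nd (between-qr q<s s<r)

mainTheorem6 : (n : ℕ) → 26177082 ≤ n → S₃ n
mainTheorem6 n n≥ =
  prime∤n⇒S₃ (proj₁ p-nondivisor) (proj₁ q-nondivisor) (proj₁ r-nondivisor) p<q q<r
    (proj₂ p-nondivisor) (proj₂ q-nondivisor) (proj₂ r-nondivisor)
    (≤-trans (threshold≤2r⁴ p<q q<r) (2r⁴≤n n≥))
  where
  T : ThreeLeastPrimeNondivisors n
  T = threeLeastPrimeNondivisors (≤-trans (s≤s z≤n) n≥)
  open ThreeLeastPrimeNondivisors T
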